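{- Let $p$ be a prime with $p>3$. Then \[ \sum_{\substack{0< i<j< p\\ i\text{ odd},\ j\text{ even}}} \frac{1}{ij}\equiv 0\pmod{p}, \] where the sum ranges over all pairs of integers $(i,j)$ with $0<i<j<p$, $i$ odd and $j$ even.
   Context: For an integer $m$ not divisible by $p$, $\frac{1}{m}$ denotes the multiplicative inverse of $m$ modulo $p$; thus $\frac{1}{ij}$ is the inverse of $ij$ modulo $p$, and the congruence is an identity in $\mathbb{Z}/p\mathbb{Z}$. -}

module Defs where

open import Data.Nat using (ℕ; zero; suc; _*_)
open import Data.Nat.Divisibility using (_∣_)
open import Data.Bool using (Bool; true; false; if_then_else_; not)
open import Data.List using (List; map; upTo)
open import Data.Nat.ListAction using (sum)
open import Data.Nat using (_%_; NonZero)
open import Relation.Nullary using (¬_)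
open import Relation.Binary.PropositionalEquality using (_≡_)

isEven : ℕ → Bool
isEven zero = true
isEven (suc n) = not (isEven n)

oddEvenPairSum : ℕ → (ℕ → ℕ → ℕ) → ℕ
oddEvenPairSum p f =
  sum (map (λ j → if isEven j then
                    sum (map (λ i → if not (isEven i) then f i j else 0) (upTo j))
                  else 0)
           (upTo p))

IsInverseMod : (p : ℕ) → .{{NonZero p}} → (ℕ → ℕ) → Set
IsInverseMod p inv = ∀ m → ¬ (p ∣ m) → (m * inv m) % p ≡ 1 % p

{-# OPTIONS --safe #-}
module Submission where

-- Write p = 2h + 1 and u m for the inverse of m modulo p. Putting j = 2l and
-- i = 2k + 1 = p - 2(h - k), the term 1/(ij) becomes -(1/4) u l u (h - k), so the sum is
-- -(1/4) U h, where U n = Σ u l u t over 1 ≤ l, t ≤ n < l + t. The partial fraction identity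
-- 1/(lt) = (1/(l + t)) (1/l + 1/t) for l + t < p shows that the complementary sum over
-- l + t ≤ n is H n ² - H₂ n, where H n = Σ_{l ≤ n} u l and H₂ n = Σ_{l ≤ n} u l ², so U n = H₂ n.
-- Finally u (p - l) = -u l gives H (2h) = 0, H₂ (2h) = 2 H₂ h and U (2h) = -(D + H₂ (2h)) with
-- D = Σ u l u t over t < l ≤ 2h. As H ² = 2D + H₂, this gives 3 H₂ (2h) = 0, so H₂ h = 0
-- because 2 and 3 are invertible modulo p > 3.

open import Algebra.Bundles using (CommutativeRing)
open import Algebra.Core using (Op₁; Op₂)
open import Algebra.Definitions using (Congruent₁; Congruent₂)
open import Algebra.Structures using (IsCommutativeRing)
open import Data.Bool using (true; not; if_then_else_)
open import Data.Bool.Properties using (if-float; if-not)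
open import Data.Integer as ℤ using (ℤ; +_)
import Data.Integer.Properties as ℤ
open import Data.Integer.Divisibility.Signed using (_∣_; divides; ∣⇒∣ᵤ; ∣m⇒∣-m; ∣m∣n⇒∣m+n; ∣m⇒∣m*n; ∣n⇒∣m*n)
open import Data.Integer.Tactic.RingSolver using (solve-∀)
open import Data.List using (map; upTo; _++_; _∷ʳ_; [_])
open import Data.List.Properties using (upTo-∷ʳ; map-++)
open import Data.Maybe.Base using (nothing)
open import Data.Nat as ℕ using (ℕ; zero; suc; z≤n; s≤s; NonZero; _%_; _/_; _<_; _≤_; _∸_)
import Data.Nat.Divisibility as ℕ
open import Data.Nat.DivMod using (m≡m%n+[m/n]*n)
open import Data.Nat.ListAction using (sum)
open import Data.Nat.ListAction.Properties using (sum-++)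
open import Data.Nat.Primality using (Prime; euclidsLemma; prime⇒irreducible)
import Data.Nat.Properties as ℕₚ
open ℕₚ using (n<1+n; m<n⇒m<1+n)
import Data.Nat.Tactic.RingSolver as ℕ-Solver
open import Data.Product using (_,_; ∃-syntax)
open import Data.Sum using (_⊎_; inj₁; inj₂; [_,_]′)
open import Level using (0ℓ)
open import Relation.Binary.Core using (Rel)
open import Relation.Binary.PropositionalEquality using (_≡_; refl; sym; trans; cong; cong₂; subst; module ≡-Reasoning)
open import Relation.Binary.Structures using (IsEquivalence)
open import Relation.Nullary using (¬_; contradiction)
open import Tactic.RingSolver.Core.AlmostCommutativeRing using (fromCommutativeRing)

open import Defs

module _ {a ℓ} {A : Set a} {_≈_ : Rel A ℓ} {_+_ _*_ : Op₂ A} { -_ : Op₁ A } {0# 1# : A} where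

  coarsen-isCommutativeRing : IsCommutativeRing _≡_ _+_ _*_ -_ 0# 1# → IsEquivalence _≈_ →
                              Congruent₂ _≈_ _+_ → Congruent₂ _≈_ _*_ → Congruent₁ _≈_ -_ →
                              IsCommutativeRing _≈_ _+_ _*_ -_ 0# 1#
  coarsen-isCommutativeRing R isEquivalence +-cong *-cong -‿cong = record
    { isRing = record
      { +-isAbelianGroup = record
        { isGroup = record
          { isMonoid = record
            { isSemigroup = record
              { isMagma = record { isEquivalence = isEquivalence ; ∙-cong = +-cong }
              ; assoc = λ x y z → ≡⇒≈ (R.+-assoc x y z)
              }
            ; identity = (λ x → ≡⇒≈ (R.+-identityˡ x)) , (λ x → ≡⇒≈ (R.+-identityʳ x))
            }
          ; inverse = (λ x → ≡⇒≈ (R.-‿inverseˡ x)) , (λ x → ≡⇒≈ (R.-‿inverseʳ x))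
          ; ⁻¹-cong = -‿cong
          }
        ; comm = λ x y → ≡⇒≈ (R.+-comm x y)
        }
      ; *-cong = *-cong
      ; *-assoc = λ x y z → ≡⇒≈ (R.*-assoc x y z)
      ; *-identity = (λ x → ≡⇒≈ (R.*-identityˡ x)) , (λ x → ≡⇒≈ (R.*-identityʳ x))
      ; distrib = (λ x y z → ≡⇒≈ (R.distribˡ x y z)) , (λ x y z → ≡⇒≈ (R.distribʳ x y z))
      }
    ; *-comm = λ x y → ≡⇒≈ (R.*-comm x y)
    }
    where
    module R = IsCommutativeRing R
    ≡⇒≈ : ∀ {x y} → x ≡ y → x ≈ y
    ≡⇒≈ refl = IsEquivalence.refl isEquivalence

module Modulo (n : ℕ) where

  -- A record rather than a synonym, so that unification never unfolds ℤ's operations.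
  infix 4 _≈_
  record _≈_ (a b : ℤ) : Set where
    constructor congruent
    field
      ∣-difference : + n ∣ a ℤ.- b

  open _≈_

  private
    by : ∀ {a b x} → x ≡ a ℤ.- b → + n ∣ x → a ≈ b
    by eq n∣x = congruent (subst (+ n ∣_) eq n∣x)

  ≈-isEquivalence : IsEquivalence _≈_
  ≈-isEquivalence = record
    { refl  = λ {a} → by (sym (ℤ.+-inverseʳ a)) (divides (+ 0) refl)
    ; sym   = λ {a} {b} a≈b → by (flip a b) (∣m⇒∣-m (∣-difference a≈b))
    ; trans = λ {a} {b} {c} a≈b b≈c → by (chain a b c) (∣m∣n⇒∣m+n (∣-difference a≈b) (∣-difference b≈c))
    }
    where
    flip : ∀ a b → ℤ.- (a ℤ.- b) ≡ b ℤ.- a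
    flip = solve-∀
    chain : ∀ a b c → (a ℤ.- b) ℤ.+ (b ℤ.- c) ≡ a ℤ.- c
    chain = solve-∀

  open IsEquivalence ≈-isEquivalence using () renaming (sym to ≈-sym; trans to ≈-trans)

  +-cong : Congruent₂ _≈_ ℤ._+_
  +-cong {a} {b} {c} {d} (congruent n∣a-b) (congruent n∣c-d) = by (split a b c d) (∣m∣n⇒∣m+n n∣a-b n∣c-d)
    where
    split : ∀ a b c d → (a ℤ.- b) ℤ.+ (c ℤ.- d) ≡ (a ℤ.+ c) ℤ.- (b ℤ.+ d)
    split = solve-∀

  *-cong : Congruent₂ _≈_ ℤ._*_
  *-cong {a} {b} {c} {d} (congruent n∣a-b) (congruent n∣c-d) =
    by (split a b c d) (∣m∣n⇒∣m+n (∣m⇒∣m*n c n∣a-b) (∣n⇒∣m*n b n∣c-d))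
    where
    split : ∀ a b c d → (a ℤ.- b) ℤ.* c ℤ.+ b ℤ.* (c ℤ.- d) ≡ a ℤ.* c ℤ.- b ℤ.* d
    split = solve-∀

  -‿cong : Congruent₁ _≈_ (λ a → ℤ.- a)
  -‿cong {a} {b} (congruent n∣a-b) = by (negate a b) (∣m⇒∣-m n∣a-b)
    where
    negate : ∀ a b → ℤ.- (a ℤ.- b) ≡ ℤ.- a ℤ.- ℤ.- b
    negate = solve-∀

  commutativeRing : CommutativeRing 0ℓ 0ℓ
  commutativeRing = record
    { Carrier = ℤ ; _≈_ = _≈_ ; _+_ = ℤ._+_ ; _*_ = ℤ._*_ ; -_ = λ a → ℤ.- a ; 0# = + 0 ; 1# = + 1
    ; isCommutativeRing = coarsen-isCommutativeRing ℤ.+-*-isCommutativeRing ≈-isEquivalence +-cong *-cong -‿cong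
    }

  n≈0 : + n ≈ + 0
  n≈0 = by (sym (ℤ.+-identityʳ (+ n))) (divides (+ 1) (sym (ℤ.*-identityˡ (+ n))))

  ≈0⇒∣ : ∀ {m} → + m ≈ + 0 → n ℕ.∣ m
  ≈0⇒∣ {m} (congruent n∣m-0) = ∣⇒∣ᵤ (subst (+ n ∣_) (ℤ.+-identityʳ (+ m)) n∣m-0)

  module _ .{{_ : NonZero n}} where

    m≈m%n : ∀ m → + m ≈ + (m % n)
    m≈m%n m = by (sym (begin
      + m ℤ.- + r                             ≡⟨ cong (λ k → + k ℤ.- + r) (m≡m%n+[m/n]*n m n) ⟩
      + (r ℕ.+ m / n ℕ.* n) ℤ.- + r           ≡⟨ cong (ℤ._- + r) (ℤ.pos-+ r (m / n ℕ.* n)) ⟩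
      (+ r ℤ.+ + (m / n ℕ.* n)) ℤ.- + r       ≡⟨ cancel (+ r) (+ (m / n ℕ.* n)) ⟩
      + (m / n ℕ.* n)                         ∎)) (divides (+ (m / n)) (ℤ.pos-* (m / n) n))
      where
      open ≡-Reasoning
      r = m % n
      cancel : ∀ a b → (a ℤ.+ b) ℤ.- a ≡ b
      cancel = solve-∀

    %-≡⇒≈ : ∀ {a b} → a % n ≡ b % n → + a ≈ + b
    %-≡⇒≈ {a} {b} eq = ≈-trans (m≈m%n a) (subst (λ r → + r ≈ + b) (sym eq) (≈-sym (m≈m%n b)))

∸-suc : ∀ {m n} → n < m → m ∸ n ≡ suc (m ∸ suc n)
∸-suc n<m = ℕₚ.+-∸-assoc 1 n<m

isEven-double : ∀ k → isEven (k ℕ.+ k) ≡ true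
isEven-double zero    = refl
isEven-double (suc k) rewrite ℕₚ.+-suc k k | isEven-double k = refl

[1+2h]∸2[h∸k]≡1+2k : ∀ {h k} → k ≤ h → suc (h ℕ.+ h) ∸ ((h ∸ k) ℕ.+ (h ∸ k)) ≡ suc (k ℕ.+ k)
[1+2h]∸2[h∸k]≡1+2k {h} {k} k≤h = begin
  suc (h ℕ.+ h) ∸ (d ℕ.+ d)                        ≡⟨ cong (λ x → suc (x ℕ.+ x) ∸ (d ℕ.+ d)) (sym (ℕₚ.m+[n∸m]≡n k≤h)) ⟩
  suc ((k ℕ.+ d) ℕ.+ (k ℕ.+ d)) ∸ (d ℕ.+ d)        ≡⟨ cong (_∸ (d ℕ.+ d)) (shuffle k d) ⟩
  suc (k ℕ.+ k) ℕ.+ (d ℕ.+ d) ∸ (d ℕ.+ d)          ≡⟨ ℕₚ.m+n∸n≡m (suc (k ℕ.+ k)) (d ℕ.+ d) ⟩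
  suc (k ℕ.+ k)                                    ∎
  where
  open ≡-Reasoning
  d = h ∸ k
  shuffle : ∀ k d → suc ((k ℕ.+ d) ℕ.+ (k ℕ.+ d)) ≡ suc (k ℕ.+ k) ℕ.+ (d ℕ.+ d)
  shuffle = ℕ-Solver.solve-∀

even-or-odd : ∀ n → (∃[ h ] n ≡ h ℕ.+ h) ⊎ (∃[ h ] n ≡ suc (h ℕ.+ h))
even-or-odd zero = inj₁ (0 , refl)
even-or-odd (suc n) with even-or-odd n
... | inj₁ (h , refl) = inj₂ (h , refl)
... | inj₂ (h , refl) = inj₁ (suc h , cong suc (sym (ℕₚ.+-suc h h)))

n+n≡2*n : ∀ n → n ℕ.+ n ≡ 2 ℕ.* n
n+n≡2*n n = cong (n ℕ.+_) (sym (ℕₚ.+-identityʳ n))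

2∣n+n : ∀ n → 2 ℕ.∣ n ℕ.+ n
2∣n+n n = ℕ.divides n (trans (n+n≡2*n n) (ℕₚ.*-comm 2 n))

odd-prime : ∀ {p} → Prime p → 2 < p → ∃[ h ] p ≡ suc (h ℕ.+ h)
odd-prime {p} p-prime 2<p with even-or-odd p
... | inj₂ odd = odd
... | inj₁ (h , refl) with prime⇒irreducible p-prime (2∣n+n h)
...   | inj₁ ()
...   | inj₂ 2≡p = contradiction 2≡p (ℕₚ.<⇒≢ 2<p)

module Sums {c ℓ} (R : CommutativeRing c ℓ) where

  open CommutativeRing R renaming (refl to ≈-refl; sym to ≈-sym; trans to ≈-trans)
  open import Relation.Binary.Reasoning.Setoid setoid
  open import Algebra.Properties.Ring ring using (-0#≈0#; -‿+-comm)
  open import Algebra.Properties.CommutativeSemigroup +-commutativeSemigroup using (interchange)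

  ∑< : ℕ → (ℕ → Carrier) → Carrier
  ∑< zero    f = 0#
  ∑< (suc n) f = ∑< n f + f n

  syntax ∑< n (λ k → e) = ∑[ k < n ] e

  ∑-cong : ∀ n {f g} → (∀ k → k < n → f k ≈ g k) → ∑< n f ≈ ∑< n g
  ∑-cong zero    f≈g = ≈-refl
  ∑-cong (suc n) f≈g = +-cong (∑-cong n (λ k k<n → f≈g k (m<n⇒m<1+n k<n))) (f≈g n (n<1+n n))

  ∑-cong-≗ : ∀ n {f g} → (∀ k → f k ≡ g k) → ∑< n f ≡ ∑< n g
  ∑-cong-≗ zero    f≗g = refl
  ∑-cong-≗ (suc n) f≗g = cong₂ _+_ (∑-cong-≗ n f≗g) (f≗g n)

  ∑-distrib-+ : ∀ n f g → ∑[ k < n ] (f k + g k) ≈ ∑< n f + ∑< n g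
  ∑-distrib-+ zero    f g = ≈-sym (+-identityˡ 0#)
  ∑-distrib-+ (suc n) f g = ≈-trans (+-congʳ (∑-distrib-+ n f g)) (interchange (∑< n f) (∑< n g) (f n) (g n))

  *-distribˡ-∑ : ∀ a n f → a * ∑< n f ≈ ∑[ k < n ] (a * f k)
  *-distribˡ-∑ a zero    f = zeroʳ a
  *-distribˡ-∑ a (suc n) f = ≈-trans (distribˡ a (∑< n f) (f n)) (+-congʳ (*-distribˡ-∑ a n f))

  ∑-neg : ∀ n f → ∑[ k < n ] (- f k) ≈ - ∑< n f
  ∑-neg zero    f = ≈-sym -0#≈0#
  ∑-neg (suc n) f = ≈-trans (+-congʳ (∑-neg n f)) (-‿+-comm (∑< n f) (f n))

  ∑-suc : ∀ n f → ∑< (suc n) f ≈ f 0 + ∑[ k < n ] f (suc k)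
  ∑-suc zero    f = +-comm 0# (f 0)
  ∑-suc (suc n) f = ≈-trans (+-congʳ (∑-suc n f)) (+-assoc (f 0) _ _)

  ∑-reverse : ∀ n f → ∑[ k < n ] f (n ∸ suc k) ≈ ∑< n f
  ∑-reverse zero    f = ≈-refl
  ∑-reverse (suc n) f = begin
    ∑[ k < suc n ] f (n ∸ k)         ≈⟨ ∑-suc n (λ k → f (n ∸ k)) ⟩
    f n + ∑[ k < n ] f (n ∸ suc k)   ≈⟨ +-congˡ (∑-reverse n f) ⟩
    f n + ∑< n f                     ≈⟨ +-comm (f n) (∑< n f) ⟩
    ∑< (suc n) f                     ∎

  ∑-split : ∀ m n f → ∑< (m ℕ.+ n) f ≈ ∑< m f + ∑[ k < n ] f (m ℕ.+ k)
  ∑-split m zero    f rewrite ℕₚ.+-identityʳ m = ≈-sym (+-identityʳ (∑< m f))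
  ∑-split m (suc n) f rewrite ℕₚ.+-suc m n = ≈-trans (+-congʳ (∑-split m n f)) (+-assoc (∑< m f) _ _)

  ∑-fold : ∀ n f → ∑< (n ℕ.+ n) f ≈ ∑[ k < n ] (f k + f (n ℕ.+ n ∸ suc k))
  ∑-fold n f = begin
    ∑< (n ℕ.+ n) f                                 ≈⟨ ∑-split n n f ⟩
    ∑< n f + ∑[ k < n ] f (n ℕ.+ k)                 ≈⟨ +-congˡ (≈-sym (∑-reverse n (λ k → f (n ℕ.+ k)))) ⟩
    ∑< n f + ∑[ k < n ] f (n ℕ.+ (n ∸ suc k))       ≈⟨ +-congˡ (∑-cong n (λ k k<n → reflexive (cong f (sym (ℕₚ.+-∸-assoc n k<n))))) ⟩
    ∑< n f + ∑[ k < n ] f (n ℕ.+ n ∸ suc k)         ≈⟨ ∑-distrib-+ n f (λ k → f (n ℕ.+ n ∸ suc k)) ⟨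
    ∑[ k < n ] (f k + f (n ℕ.+ n ∸ suc k))         ∎

  ∑-pairs : ∀ n f → ∑< (n ℕ.+ n) f ≈ ∑[ k < n ] (f (k ℕ.+ k) + f (suc (k ℕ.+ k)))
  ∑-pairs zero    f = ≈-refl
  ∑-pairs (suc n) f rewrite ℕₚ.+-suc n n = ≈-trans (+-congʳ (+-congʳ (∑-pairs n f))) (+-assoc _ (f (n ℕ.+ n)) _)

  ∑-parity : ∀ n (a b : ℕ → Carrier) →
             ∑[ j < n ℕ.+ n ] (if isEven j then a j else b j) ≈ ∑[ k < n ] (a (k ℕ.+ k) + b (suc (k ℕ.+ k)))
  ∑-parity n a b = ≈-trans (∑-pairs n _) (∑-cong n (λ k _ → reflexive (parity k)))
    where
    parity : ∀ k → (if isEven (k ℕ.+ k) then a (k ℕ.+ k) else b (k ℕ.+ k))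
                   + (if isEven (suc (k ℕ.+ k)) then a (suc (k ℕ.+ k)) else b (suc (k ℕ.+ k)))
                 ≡ a (k ℕ.+ k) + b (suc (k ℕ.+ k))
    parity k rewrite isEven-double k = refl

module CommutativeRingLemmas {c ℓ} (R : CommutativeRing c ℓ) where

  open CommutativeRing R
  open import Relation.Binary.Reasoning.Setoid setoid
  open import Algebra.Properties.Ring ring using (-‿involutive; -‿distribˡ-*; -‿distribʳ-*)

  -x*-y≈x*y : ∀ x y → - x * - y ≈ x * y
  -x*-y≈x*y x y = begin
    - x * - y    ≈⟨ -‿distribˡ-* x (- y) ⟨
    - (x * - y)  ≈⟨ -‿cong (-‿distribʳ-* x y) ⟨
    - - (x * y)  ≈⟨ -‿involutive (x * y) ⟩
    x * y        ∎

  unit-cancelˡ : ∀ {a b x y} → b * a ≈ 1# → a * x ≈ a * y → x ≈ y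
  unit-cancelˡ {a} {b} {x} {y} ba≈1 ax≈ay = begin
    x            ≈⟨ *-identityˡ x ⟨
    1# * x       ≈⟨ *-congʳ ba≈1 ⟨
    (b * a) * x  ≈⟨ *-assoc b a x ⟩
    b * (a * x)  ≈⟨ *-congˡ ax≈ay ⟩
    b * (a * y)  ≈⟨ *-assoc b a y ⟨
    (b * a) * y  ≈⟨ *-congʳ ba≈1 ⟩
    1# * y       ≈⟨ *-identityˡ y ⟩
    y            ∎

module Harmonic {c ℓ} (R : CommutativeRing c ℓ) (u : ℕ → CommutativeRing.Carrier R) where

  open CommutativeRing R renaming (refl to ≈-refl; sym to ≈-sym; trans to ≈-trans)
  open Sums R
  open import Relation.Binary.Reasoning.Setoid setoid
  open import Tactic.RingSolver.NonReflective (fromCommutativeRing R (λ _ → nothing))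
  open import Algebra.Properties.Ring ring using (+-cancelˡ; -‿distribʳ-*)
  open CommutativeRingLemmas R using (-x*-y≈x*y)
  open import Algebra.Properties.CommutativeSemigroup +-commutativeSemigroup using (interchange; xy∙z≈x∙zy)

  -- With l = suc k, these are the sums of u l * u t over 1 ≤ l, t ≤ n subject to
  -- l + t ≤ n (L), n < l + t (U) and t < l (D).
  H H₂ L U D : ℕ → Carrier
  H n  = ∑[ k < n ] u (suc k)
  H₂ n = ∑[ k < n ] (u (suc k) * u (suc k))
  L n  = ∑[ k < n ] (u (suc k) * H (n ∸ suc k))
  U n  = ∑[ k < n ] (u (suc k) * ∑[ j < suc k ] u (n ∸ j))
  D n  = ∑[ k < n ] (u (suc k) * H k)

  +-square : ∀ a b → (a + b) * (a + b) ≈ a * a + ((b * a + b * a) + b * b)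
  +-square = solve 2 (λ a b → ((a ⊕ b) ⊗ (a ⊕ b)) ⊜ (a ⊗ a ⊕ ((b ⊗ a ⊕ b ⊗ a) ⊕ b ⊗ b))) ≈-refl

  H²≈D+D+H₂ : ∀ n → H n * H n ≈ (D n + D n) + H₂ n
  H²≈D+D+H₂ zero    = ≈-trans (zeroˡ 0#) (≈-sym (≈-trans (+-identityʳ _) (+-identityʳ 0#)))
  H²≈D+D+H₂ (suc n) = begin
    (H n + v) * (H n + v)                     ≈⟨ +-square (H n) v ⟩
    H n * H n + ((w + w) + v * v)             ≈⟨ +-congʳ (H²≈D+D+H₂ n) ⟩
    ((D n + D n) + H₂ n) + ((w + w) + v * v)  ≈⟨ interchange (D n + D n) (H₂ n) (w + w) (v * v) ⟩
    ((D n + D n) + (w + w)) + (H₂ n + v * v)  ≈⟨ +-congʳ (interchange (D n) (D n) w w) ⟩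
    ((D n + w) + (D n + w)) + (H₂ n + v * v)  ∎
    where
    v = u (suc n)
    w = v * H n

  H-∸-suc : ∀ {n l} → l < n → H (n ∸ suc l) + u (n ∸ l) ≈ H (n ∸ l)
  H-∸-suc l<n rewrite ∸-suc l<n = ≈-refl

  H-tail : ∀ n l → l ≤ n → ∑[ j < l ] u (n ∸ j) + H (n ∸ l) ≈ H n
  H-tail n zero    _    = +-identityˡ (H n)
  H-tail n (suc l) l<n = begin
    (∑[ j < l ] u (n ∸ j) + u (n ∸ l)) + H (n ∸ suc l) ≈⟨ xy∙z≈x∙zy _ _ _ ⟩
    ∑[ j < l ] u (n ∸ j) + (H (n ∸ suc l) + u (n ∸ l)) ≈⟨ +-congˡ (H-∸-suc l<n) ⟩
    ∑[ j < l ] u (n ∸ j) + H (n ∸ l)                   ≈⟨ H-tail n l (ℕₚ.<⇒≤ l<n) ⟩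
    H n                                               ∎

  H[n∸n]≈0 : ∀ n → H (n ∸ n) ≈ 0#
  H[n∸n]≈0 n rewrite ℕₚ.n∸n≡0 n = ≈-refl

  H-reverse : ∀ n → ∑[ k < n ] u (n ∸ k) ≈ H n
  H-reverse n = ≈-trans (≈-sym (+-identityʳ _)) (≈-trans (+-congˡ (≈-sym (H[n∸n]≈0 n))) (H-tail n n ℕₚ.≤-refl))

  L+U≈H² : ∀ n → L n + U n ≈ H n * H n
  L+U≈H² n = begin
    L n + U n                                                  ≈⟨ ∑-distrib-+ n _ _ ⟨
    ∑[ k < n ] (u (suc k) * H (n ∸ suc k) + u (suc k) * T k)  ≈⟨ ∑-cong n row ⟩
    ∑[ k < n ] (H n * u (suc k))                               ≈⟨ *-distribˡ-∑ (H n) n _ ⟨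
    H n * H n                                                  ∎
    where
    T : ℕ → Carrier
    T k = ∑[ j < suc k ] u (n ∸ j)
    row : ∀ k → k < n → u (suc k) * H (n ∸ suc k) + u (suc k) * T k ≈ H n * u (suc k)
    row k k<n = begin
      u (suc k) * H (n ∸ suc k) + u (suc k) * T k ≈⟨ distribˡ (u (suc k)) _ _ ⟨
      u (suc k) * (H (n ∸ suc k) + T k)           ≈⟨ *-congˡ (+-comm _ (T k)) ⟩
      u (suc k) * (T k + H (n ∸ suc k))           ≈⟨ *-congˡ (H-tail n (suc k) k<n) ⟩
      u (suc k) * H n                             ≈⟨ *-comm (u (suc k)) (H n) ⟩
      H n * u (suc k)                             ∎

  PartialFractions : ℕ → Set ℓ
  PartialFractions N = ∀ {l n} → 0 < l → l < n → n ≤ N → u l * u (n ∸ l) ≈ u n * (u l + u (n ∸ l))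

  antidiagonal : ∀ n → PartialFractions (suc n) → ∑[ k < n ] (u (suc k) * u (n ∸ k)) ≈ u (suc n) * (H n + H n)
  antidiagonal n pf = begin
    ∑[ k < n ] (u (suc k) * u (n ∸ k))               ≈⟨ ∑-cong n (λ k k<n → pf (s≤s z≤n) (s≤s k<n) ℕₚ.≤-refl) ⟩
    ∑[ k < n ] (u (suc n) * (u (suc k) + u (n ∸ k))) ≈⟨ *-distribˡ-∑ (u (suc n)) n _ ⟨
    u (suc n) * ∑[ k < n ] (u (suc k) + u (n ∸ k))   ≈⟨ *-congˡ (∑-distrib-+ n _ _) ⟩
    u (suc n) * (H n + ∑[ k < n ] u (n ∸ k))         ≈⟨ *-congˡ (+-congˡ (H-reverse n)) ⟩
    u (suc n) * (H n + H n)                          ∎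

  L-suc : ∀ n → L (suc n) ≈ L n + ∑[ k < n ] (u (suc k) * u (n ∸ k))
  L-suc n = begin
    ∑[ k < n ] (u (suc k) * H (n ∸ k)) + u (suc n) * H (n ∸ n)    ≈⟨ +-congˡ (≈-trans (*-congˡ (H[n∸n]≈0 n)) (zeroʳ _)) ⟩
    ∑[ k < n ] (u (suc k) * H (n ∸ k)) + 0#                       ≈⟨ +-identityʳ _ ⟩
    ∑[ k < n ] (u (suc k) * H (n ∸ k))                            ≈⟨ ∑-cong n split ⟩
    ∑[ k < n ] (u (suc k) * H (n ∸ suc k) + u (suc k) * u (n ∸ k)) ≈⟨ ∑-distrib-+ n _ _ ⟩
    L n + ∑[ k < n ] (u (suc k) * u (n ∸ k))                       ∎
    where
    split : ∀ k → k < n → u (suc k) * H (n ∸ k) ≈ u (suc k) * H (n ∸ suc k) + u (suc k) * u (n ∸ k)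
    split k k<n = ≈-trans (*-congˡ (≈-sym (H-∸-suc k<n))) (distribˡ _ _ _)

  L+H₂≈H² : ∀ n → PartialFractions n → L n + H₂ n ≈ H n * H n
  L+H₂≈H² zero    _  = ≈-trans (+-identityʳ 0#) (≈-sym (zeroˡ 0#))
  L+H₂≈H² (suc n) pf = begin
    L (suc n) + H₂ (suc n)                       ≈⟨ +-congʳ (≈-trans (L-suc n) (+-congˡ (antidiagonal n pf))) ⟩
    (L n + v * (H n + H n)) + (H₂ n + v * v)     ≈⟨ interchange (L n) _ (H₂ n) _ ⟩
    (L n + H₂ n) + (v * (H n + H n) + v * v)     ≈⟨ +-congʳ (L+H₂≈H² n (λ 0<l l<m m≤n → pf 0<l l<m (ℕₚ.m≤n⇒m≤1+n m≤n))) ⟩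
    H n * H n + (v * (H n + H n) + v * v)        ≈⟨ +-congˡ (+-congʳ (distribˡ v (H n) (H n))) ⟩
    H n * H n + ((v * H n + v * H n) + v * v)    ≈⟨ +-square (H n) v ⟨
    (H n + v) * (H n + v)                        ∎
    where v = u (suc n)

  U≈H₂ : ∀ n → PartialFractions n → U n ≈ H₂ n
  U≈H₂ n pf = +-cancelˡ (L n) (U n) (H₂ n) (≈-trans (L+U≈H² n) (≈-sym (L+H₂≈H² n pf)))

  Reflection : ℕ → Set ℓ
  Reflection m = ∀ {l} → 0 < l → l ≤ m → u (suc m ∸ l) ≈ - u l

  module _ (m : ℕ) (reflection : Reflection m) where

    reflect : ∀ {k} → k < m → u (m ∸ k) ≈ - u (suc k)
    reflect k<m = reflection (s≤s z≤n) k<m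

    reflect-suc : ∀ {k} → k < m → u (suc (m ∸ suc k)) ≈ - u (suc k)
    reflect-suc k<m rewrite sym (∸-suc k<m) = reflect k<m

    U-reflection : U m ≈ - (D m + H₂ m)
    U-reflection = begin
      U m                                                   ≈⟨ ∑-cong m row ⟩
      ∑[ k < m ] (- (u (suc k) * H k + u (suc k) * u (suc k))) ≈⟨ ∑-neg m _ ⟩
      - ∑[ k < m ] (u (suc k) * H k + u (suc k) * u (suc k))   ≈⟨ -‿cong (∑-distrib-+ m _ _) ⟩
      - (D m + H₂ m)                                        ∎
      where
      row : ∀ k → k < m → u (suc k) * ∑[ j < suc k ] u (m ∸ j) ≈ - (u (suc k) * H k + u (suc k) * u (suc k))
      row k k<m = begin
        u (suc k) * ∑[ j < suc k ] u (m ∸ j)          ≈⟨ *-congˡ (∑-cong (suc k) (λ j j≤k → reflect (ℕₚ.<-≤-trans j≤k k<m))) ⟩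
        u (suc k) * ∑[ j < suc k ] (- u (suc j))       ≈⟨ *-congˡ (∑-neg (suc k) _) ⟩
        u (suc k) * - H (suc k)                        ≈⟨ -‿distribʳ-* (u (suc k)) (H (suc k)) ⟨
        - (u (suc k) * (H k + u (suc k)))               ≈⟨ -‿cong (distribˡ (u (suc k)) (H k) (u (suc k))) ⟩
        - (u (suc k) * H k + u (suc k) * u (suc k))     ∎

  module _ (h : ℕ) (reflection : Reflection (h ℕ.+ h)) where

    private
      reflect-half : ∀ {k} → k < h → u (suc (h ℕ.+ h ∸ suc k)) ≈ - u (suc k)
      reflect-half k<h = reflect-suc (h ℕ.+ h) reflection (ℕₚ.<-≤-trans k<h (ℕₚ.m≤m+n h h))

    H-reflection : H (h ℕ.+ h) ≈ 0#
    H-reflection = begin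
      H (h ℕ.+ h)                                        ≈⟨ ∑-fold h (λ k → u (suc k)) ⟩
      ∑[ k < h ] (u (suc k) + u (suc (h ℕ.+ h ∸ suc k))) ≈⟨ ∑-cong h (λ k k<h → +-congˡ (reflect-half k<h)) ⟩
      ∑[ k < h ] (u (suc k) + - u (suc k))               ≈⟨ ∑-distrib-+ h _ _ ⟩
      H h + ∑[ k < h ] (- u (suc k))                     ≈⟨ +-congˡ (∑-neg h _) ⟩
      H h + - H h                                        ≈⟨ -‿inverseʳ (H h) ⟩
      0#                                                 ∎

    H₂-reflection : H₂ (h ℕ.+ h) ≈ H₂ h + H₂ h
    H₂-reflection = begin
      H₂ (h ℕ.+ h)                                                    ≈⟨ ∑-fold h (λ k → u (suc k) * u (suc k)) ⟩
      ∑[ k < h ] (u (suc k) * u (suc k) + u (suc (h ℕ.+ h ∸ suc k)) * u (suc (h ℕ.+ h ∸ suc k)))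
                                                                     ≈⟨ ∑-cong h (λ k k<h → +-congˡ (square-reflect k<h)) ⟩
      ∑[ k < h ] (u (suc k) * u (suc k) + u (suc k) * u (suc k))      ≈⟨ ∑-distrib-+ h _ _ ⟩
      H₂ h + H₂ h                                                     ∎
      where
      square-reflect : ∀ {k} → k < h → u (suc (h ℕ.+ h ∸ suc k)) * u (suc (h ℕ.+ h ∸ suc k)) ≈ u (suc k) * u (suc k)
      square-reflect k<h = ≈-trans (*-cong (reflect-half k<h) (reflect-half k<h)) (-x*-y≈x*y _ _)

    3H₂≈0 : PartialFractions (h ℕ.+ h) → H₂ (h ℕ.+ h) + H₂ (h ℕ.+ h) + H₂ (h ℕ.+ h) ≈ 0#
    3H₂≈0 pf = begin
      q + q + q                            ≈⟨ +-congˡ (+-identityˡ q) ⟨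
      (q + q) + (0# + q)                   ≈⟨ +-congˡ (+-congʳ H²≈0) ⟨
      (q + q) + (((d + d) + q) + q)        ≈⟨ +-congˡ (+-assoc (d + d) q q) ⟩
      (q + q) + ((d + d) + (q + q))        ≈⟨ +-congˡ (interchange d q d q) ⟨
      (q + q) + ((d + q) + (d + q))        ≈⟨ interchange q (d + q) q (d + q) ⟨
      (q + (d + q)) + (q + (d + q))        ≈⟨ +-cong q+[d+q]≈0 q+[d+q]≈0 ⟩
      0# + 0#                              ≈⟨ +-identityʳ 0# ⟩
      0#                                   ∎
      where
      m = h ℕ.+ h
      q = H₂ m
      d = D m
      H²≈0 : (d + d) + q ≈ 0#
      H²≈0 = begin
        (d + d) + q  ≈⟨ H²≈D+D+H₂ m ⟨
        H m * H m    ≈⟨ *-cong H-reflection H-reflection ⟩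
        0# * 0#      ≈⟨ zeroˡ 0# ⟩
        0#           ∎
      q+[d+q]≈0 : q + (d + q) ≈ 0#
      q+[d+q]≈0 = begin
        q + (d + q)        ≈⟨ +-congʳ (U≈H₂ m pf) ⟨
        U m + (d + q)      ≈⟨ +-congʳ (U-reflection m reflection) ⟩
        - (d + q) + (d + q) ≈⟨ -‿inverseˡ (d + q) ⟩
        0#                 ∎

module Reciprocals (p : ℕ) .{{_ : NonZero p}} (p-prime : Prime p) (inv : ℕ → ℕ) (inverse : IsInverseMod p inv) where

  open Modulo p using (commutativeRing; n≈0; %-≡⇒≈)
  open CommutativeRing commutativeRing renaming (refl to ≈-refl; sym to ≈-sym; trans to ≈-trans)
  open CommutativeRingLemmas commutativeRing
  open import Relation.Binary.Reasoning.Setoid setoid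
  open import Algebra.Properties.Ring ring using (+-inverseˡ-unique)
  open import Algebra.Properties.CommutativeSemigroup *-commutativeSemigroup using (interchange)

  u : ℕ → ℤ
  u m = + inv m

  p∤ : ∀ {m} → 0 < m → m < p → ¬ p ℕ.∣ m
  p∤ {suc m} _ m<p p∣m = ℕₚ.<⇒≱ m<p (ℕ.∣⇒≤ p∣m)

  p∤* : ∀ {a b} → ¬ p ℕ.∣ a → ¬ p ℕ.∣ b → ¬ p ℕ.∣ a ℕ.* b
  p∤* {a} {b} p∤a p∤b p∣ab = [ p∤a , p∤b ]′ (euclidsLemma a b p-prime p∣ab)

  u-inverse : ∀ {m} → ¬ p ℕ.∣ m → + m * u m ≈ 1#
  u-inverse {m} p∤m = subst (_≈ + 1) (ℤ.pos-* m (inv m)) (%-≡⇒≈ (inverse m p∤m))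

  u-unique : ∀ {m x} → ¬ p ℕ.∣ m → + m * x ≈ 1# → x ≈ u m
  u-unique {m} p∤m mx≈1 =
    unit-cancelˡ {+ m} {u m} (≈-trans (*-comm (u m) (+ m)) (u-inverse p∤m)) (≈-trans mx≈1 (≈-sym (u-inverse p∤m)))

  u-* : ∀ {a b} → ¬ p ℕ.∣ a → ¬ p ℕ.∣ b → u (a ℕ.* b) ≈ u a * u b
  u-* {a} {b} p∤a p∤b = ≈-sym (u-unique (p∤* p∤a p∤b) (begin
    + (a ℕ.* b) * (u a * u b)    ≡⟨ cong (_* (u a * u b)) (ℤ.pos-* a b) ⟩
    (+ a * + b) * (u a * u b)    ≈⟨ interchange (+ a) (+ b) (u a) (u b) ⟩
    (+ a * u a) * (+ b * u b)    ≈⟨ *-cong (u-inverse p∤a) (u-inverse p∤b) ⟩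
    1# * 1#                      ≈⟨ *-identityˡ 1# ⟩
    1#                           ∎))

  u-reflect : ∀ {j} → 0 < j → j < p → u (p ∸ j) ≈ - u j
  u-reflect {j} 0<j j<p = ≈-sym (u-unique (p∤ (ℕₚ.m<n⇒0<n∸m j<p) (ℕₚ.∸-monoʳ-< 0<j (ℕₚ.<⇒≤ j<p))) (begin
    + (p ∸ j) * - u j    ≈⟨ *-congʳ (+-inverseˡ-unique (+ (p ∸ j)) (+ j) p∸j+j≈0) ⟩
    - + j * - u j        ≈⟨ -x*-y≈x*y (+ j) (u j) ⟩
    + j * u j            ≈⟨ u-inverse (p∤ 0<j j<p) ⟩
    1#                   ∎))
    where
    p∸j+j≈0 : + (p ∸ j) + + j ≈ 0#
    p∸j+j≈0 = subst (_≈ 0#) (trans (cong +_ (sym (ℕₚ.m∸n+n≡m (ℕₚ.<⇒≤ j<p)))) (ℤ.pos-+ (p ∸ j) j)) n≈0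

  u-partialFractions : ∀ {l n} → 0 < l → l < n → n < p → u l * u (n ∸ l) ≈ u n * (u l + u (n ∸ l))
  u-partialFractions {l} {n} 0<l l<n n<p = begin
    u l * u m           ≈⟨ u-* p∤l p∤m ⟨
    u (l ℕ.* m)         ≈⟨ u-unique (p∤* p∤l p∤m) lm*rhs≈1 ⟨
    u n * (u l + u m)   ∎
    where
    m = n ∸ l
    p∤l = p∤ 0<l (ℕₚ.<-trans l<n n<p)
    p∤m = p∤ (ℕₚ.m<n⇒0<n∸m l<n) (ℕₚ.≤-<-trans (ℕₚ.m∸n≤m n l) n<p)
    p∤n = p∤ (ℕₚ.<-trans 0<l l<n) n<p
    expand : ∀ a b x y z → (a ℤ.* b) ℤ.* (z ℤ.* (x ℤ.+ y)) ≡ z ℤ.* ((a ℤ.* x) ℤ.* b ℤ.+ (b ℤ.* y) ℤ.* a)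
    expand = solve-∀
    cancel : ∀ {a b} → ¬ p ℕ.∣ a → (+ a * u a) * b ≈ b
    cancel {a} {b} p∤a = ≈-trans (*-congʳ {b} (u-inverse p∤a)) (*-identityˡ b)
    lm*rhs≈1 : + (l ℕ.* m) * (u n * (u l + u m)) ≈ 1#
    lm*rhs≈1 = begin
      + (l ℕ.* m) * (u n * (u l + u m))               ≡⟨ cong (_* (u n * (u l + u m))) (ℤ.pos-* l m) ⟩
      (+ l * + m) * (u n * (u l + u m))               ≡⟨ expand (+ l) (+ m) (u l) (u m) (u n) ⟩
      u n * ((+ l * u l) * + m + (+ m * u m) * + l)   ≈⟨ *-congˡ {u n} (+-cong {(+ l * u l) * + m} {+ m} (cancel p∤l) (cancel p∤m)) ⟩
      u n * (+ m + + l)                               ≡⟨ cong (u n *_) (sym (ℤ.pos-+ m l)) ⟩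
      u n * + (m ℕ.+ l)                               ≡⟨ cong (λ k → u n * + k) (ℕₚ.m∸n+n≡m (ℕₚ.<⇒≤ l<n)) ⟩
      u n * + n                                       ≈⟨ *-comm (u n) (+ n) ⟩
      + n * u n                                       ≈⟨ u-inverse p∤n ⟩
      1#                                              ∎

  m*x≈0⇒x≈0 : ∀ {m x} → ¬ p ℕ.∣ m → + m * x ≈ 0# → x ≈ 0#
  m*x≈0⇒x≈0 {m} {x} p∤m mx≈0 =
    unit-cancelˡ {+ m} {u m} (≈-trans (*-comm (u m) (+ m)) (u-inverse p∤m)) (≈-trans mx≈0 (≈-sym (zeroʳ (+ m))))

module OddEvenPairSums (n : ℕ) where

  open Modulo n using (commutativeRing)
  open CommutativeRing commutativeRing renaming (refl to ≈-refl; sym to ≈-sym; trans to ≈-trans)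
  open Sums commutativeRing
  open import Relation.Binary.Reasoning.Setoid setoid

  sum-upTo : ∀ n (g : ℕ → ℕ) → + sum (map g (upTo n)) ≈ ∑[ k < n ] (+ g k)
  sum-upTo zero    g = ≈-refl
  sum-upTo (suc n) g = begin
    + sum (map g (upTo (suc n)))               ≡⟨ cong (λ xs → + sum (map g xs)) (sym (upTo-∷ʳ n)) ⟩
    + sum (map g (upTo n ∷ʳ n))                ≡⟨ cong (λ xs → + sum xs) (map-++ g (upTo n) [ n ]) ⟩
    + sum (map g (upTo n) ++ [ g n ])          ≡⟨ cong +_ (sum-++ (map g (upTo n)) [ g n ]) ⟩
    + (sum (map g (upTo n)) ℕ.+ (g n ℕ.+ 0))   ≡⟨ cong (λ x → + (sum (map g (upTo n)) ℕ.+ x)) (ℕₚ.+-identityʳ (g n)) ⟩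
    + (sum (map g (upTo n)) ℕ.+ g n)           ≡⟨ ℤ.pos-+ (sum (map g (upTo n))) (g n) ⟩
    + sum (map g (upTo n)) + + g n             ≈⟨ +-congʳ (sum-upTo n g) ⟩
    ∑[ k < suc n ] (+ g k)                       ∎

  ∑-evens : ∀ n (a : ℕ → ℕ) → ∑[ j < n ℕ.+ n ] (+ (if isEven j then a j else 0)) ≈ ∑[ k < n ] (+ a (k ℕ.+ k))
  ∑-evens n a = begin
    ∑[ j < n ℕ.+ n ] (+ (if isEven j then a j else 0))  ≡⟨ ∑-cong-≗ (n ℕ.+ n) (λ j → if-float +_ (isEven j)) ⟩
    ∑[ j < n ℕ.+ n ] (if isEven j then + a j else 0#)   ≈⟨ ∑-parity n (λ j → + a j) (λ _ → 0#) ⟩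
    ∑[ k < n ] (+ a (k ℕ.+ k) + 0#)                     ≈⟨ ∑-cong n (λ k _ → +-identityʳ (+ a (k ℕ.+ k))) ⟩
    ∑[ k < n ] (+ a (k ℕ.+ k))                          ∎

  ∑-odds : ∀ n (b : ℕ → ℕ) →
           ∑[ j < n ℕ.+ n ] (+ (if not (isEven j) then b j else 0)) ≈ ∑[ k < n ] (+ b (suc (k ℕ.+ k)))
  ∑-odds n b = begin
    ∑[ j < n ℕ.+ n ] (+ (if not (isEven j) then b j else 0))
      ≡⟨ ∑-cong-≗ (n ℕ.+ n) (λ j → trans (cong +_ (if-not (isEven j))) (if-float +_ (isEven j))) ⟩
    ∑[ j < n ℕ.+ n ] (if isEven j then 0# else + b j)   ≈⟨ ∑-parity n (λ _ → 0#) (λ j → + b j) ⟩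
    ∑[ k < n ] (0# + + b (suc (k ℕ.+ k)))               ≈⟨ ∑-cong n (λ k _ → +-identityˡ (+ b (suc (k ℕ.+ k)))) ⟩
    ∑[ k < n ] (+ b (suc (k ℕ.+ k)))                    ∎

  oddEvenPairSum-∑ : ∀ h f → + oddEvenPairSum (suc (h ℕ.+ h)) f ≈
                             ∑[ l < h ] (∑[ k < suc l ] (+ f (suc (k ℕ.+ k)) (suc l ℕ.+ suc l)))
  oddEvenPairSum-∑ h f = begin
    + oddEvenPairSum (suc (h ℕ.+ h)) f                  ≈⟨ sum-upTo (suc (h ℕ.+ h)) E ⟩
    ∑[ j < h ℕ.+ h ] (+ E j) + + E (h ℕ.+ h)             ≈⟨ +-cong (∑-evens h I) (reflexive (cong +_ last-even)) ⟩
    ∑[ k < suc h ] (+ I (k ℕ.+ k))                       ≈⟨ ∑-suc h _ ⟩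
    + I 0 + ∑[ l < h ] (+ I (suc l ℕ.+ suc l))          ≈⟨ +-identityˡ _ ⟩
    ∑[ l < h ] (+ I (suc l ℕ.+ suc l))
      ≈⟨ ∑-cong h (λ l _ → ≈-trans (sum-upTo (suc l ℕ.+ suc l) _) (∑-odds (suc l) (λ i → f i (suc l ℕ.+ suc l)))) ⟩
    ∑[ l < h ] (∑[ k < suc l ] (+ f (suc (k ℕ.+ k)) (suc l ℕ.+ suc l))) ∎
    where
    I E : ℕ → ℕ
    I j = sum (map (λ i → if not (isEven i) then f i j else 0) (upTo j))
    E j = if isEven j then I j else 0
    last-even : E (h ℕ.+ h) ≡ I (h ℕ.+ h)
    last-even rewrite isEven-double h = refl

module OddPrime (h : ℕ) (p-prime : Prime (suc (h ℕ.+ h))) (3<p : 3 < suc (h ℕ.+ h))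
                (inv : ℕ → ℕ) (inverse : IsInverseMod (suc (h ℕ.+ h)) inv) where

  p : ℕ
  p = suc (h ℕ.+ h)

  open Modulo p using (commutativeRing)
  open CommutativeRing commutativeRing renaming (refl to ≈-refl; sym to ≈-sym; trans to ≈-trans)
  open Sums commutativeRing
  open Reciprocals p p-prime inv inverse
  open Harmonic commutativeRing u
  open OddEvenPairSums p using (oddEvenPairSum-∑)
  open import Relation.Binary.Reasoning.Setoid setoid

  p∤≤ : ∀ {m} → 0 < m → m ≤ h ℕ.+ h → ¬ p ℕ.∣ m
  p∤≤ 0<m m≤2h = p∤ 0<m (s≤s m≤2h)

  partialFractions : ∀ {N} → N ≤ h ℕ.+ h → PartialFractions N
  partialFractions N≤2h 0<l l<n n≤N = u-partialFractions 0<l l<n (s≤s (ℕₚ.≤-trans n≤N N≤2h))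

  reflection : Reflection (h ℕ.+ h)
  reflection 0<l l≤2h = u-reflect 0<l (s≤s l≤2h)

  3≤2h : 3 ≤ h ℕ.+ h
  3≤2h = ℕₚ.≤-pred 3<p

  2≤2h : 2 ≤ h ℕ.+ h
  2≤2h = ℕₚ.≤-trans (ℕₚ.n≤1+n 2) 3≤2h

  H₂≈0 : H₂ h ≈ 0#
  H₂≈0 = m*x≈0⇒x≈0 (p∤≤ (s≤s z≤n) 2≤2h) (m*x≈0⇒x≈0 (p∤≤ (s≤s z≤n) 3≤2h) (begin
    + 3 * (+ 2 * q)                          ≡⟨ six q ⟩
    (q + q) + (q + q) + (q + q)              ≈⟨ +-cong (+-cong q+q≈H₂[2h] q+q≈H₂[2h]) q+q≈H₂[2h] ⟩
    H₂ m + H₂ m + H₂ m                       ≈⟨ 3H₂≈0 h reflection (partialFractions ℕₚ.≤-refl) ⟩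
    0#                                       ∎))
    where
    m = h ℕ.+ h
    q = H₂ h
    q+q≈H₂[2h] : q + q ≈ H₂ m
    q+q≈H₂[2h] = ≈-sym (H₂-reflection h reflection)
    six : ∀ q → + 3 ℤ.* (+ 2 ℤ.* q) ≡ (q ℤ.+ q) ℤ.+ (q ℤ.+ q) ℤ.+ (q ℤ.+ q)
    six = solve-∀

  u-double : ∀ {n} → 0 < n → n ≤ h → u (n ℕ.+ n) ≈ u 2 * u n
  u-double {n} 0<n n≤h = ≈-trans (reflexive (cong u (n+n≡2*n n)))
                                  (u-* (p∤≤ (s≤s z≤n) 2≤2h) (p∤≤ 0<n (ℕₚ.≤-trans n≤h (ℕₚ.m≤m+n h h))))

  u-odd : ∀ {k} → k < h → u (suc (k ℕ.+ k)) ≈ - (u 2 * u (h ∸ k))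
  u-odd {k} k<h = begin
    u (suc (k ℕ.+ k))   ≡⟨ cong u (sym ([1+2h]∸2[h∸k]≡1+2k (ℕₚ.<⇒≤ k<h))) ⟩
    u (p ∸ (d ℕ.+ d))   ≈⟨ u-reflect 0<d+d (s≤s (ℕₚ.+-mono-≤ d≤h d≤h)) ⟩
    - u (d ℕ.+ d)       ≈⟨ -‿cong (u-double 0<d d≤h) ⟩
    - (u 2 * u d)       ∎
    where
    d = h ∸ k
    d≤h = ℕₚ.m∸n≤m h k
    0<d = ℕₚ.m<n⇒0<n∸m k<h
    0<d+d = ℕₚ.<-≤-trans 0<d (ℕₚ.m≤m+n d d)

  -¼ : ℤ
  -¼ = - (u 2 * u 2)

  u-term : ∀ {l k} → 0 < l → l ≤ h → k < l → u (suc (k ℕ.+ k) ℕ.* (l ℕ.+ l)) ≈ -¼ * (u l * u (h ∸ k))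
  u-term {l} {k} 0<l l≤h k<l = begin
    u (suc (k ℕ.+ k) ℕ.* (l ℕ.+ l))      ≈⟨ u-* (p∤≤ (s≤s z≤n) (ℕₚ.+-mono-< k<h k<h)) (p∤≤ 0<l+l (ℕₚ.+-mono-≤ l≤h l≤h)) ⟩
    u (suc (k ℕ.+ k)) * u (l ℕ.+ l)      ≈⟨ *-cong {u (suc (k ℕ.+ k))} { - (u 2 * u (h ∸ k))} (u-odd k<h) (u-double 0<l l≤h) ⟩
    - (u 2 * u (h ∸ k)) * (u 2 * u l)    ≡⟨ rearrange (u 2) (u (h ∸ k)) (u l) ⟩
    -¼ * (u l * u (h ∸ k))                ∎
    where
    k<h = ℕₚ.<-≤-trans k<l l≤h
    0<l+l = ℕₚ.<-≤-trans 0<l (ℕₚ.m≤m+n l l)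
    rearrange : ∀ a b x → ℤ.- (a ℤ.* b) ℤ.* (a ℤ.* x) ≡ ℤ.- (a ℤ.* a) ℤ.* (x ℤ.* b)
    rearrange = solve-∀

  oddEvenPairSum≈0 : + oddEvenPairSum p (λ i j → inv (i ℕ.* j)) ≈ 0#
  oddEvenPairSum≈0 = begin
    + oddEvenPairSum p (λ i j → inv (i ℕ.* j))                            ≈⟨ oddEvenPairSum-∑ h _ ⟩
    ∑[ l < h ] (∑[ k < suc l ] u (suc (k ℕ.+ k) ℕ.* (suc l ℕ.+ suc l)))
      ≈⟨ ∑-cong h (λ l l<h → ∑-cong (suc l) (λ k k<l → u-term (s≤s z≤n) l<h k<l)) ⟩
    ∑[ l < h ] (∑[ k < suc l ] (-¼ * (u (suc l) * u (h ∸ k))))             ≈⟨ ∑-cong h (λ l _ → factor l) ⟨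
    ∑[ l < h ] (-¼ * (u (suc l) * ∑[ k < suc l ] u (h ∸ k)))               ≈⟨ *-distribˡ-∑ -¼ h _ ⟨
    -¼ * U h
      ≈⟨ *-congˡ { -¼ } (≈-trans (U≈H₂ h (partialFractions (ℕₚ.m≤m+n h h))) H₂≈0) ⟩
    -¼ * 0#                                                               ≈⟨ zeroʳ -¼ ⟩
    0#                                                                    ∎
    where
    factor : ∀ l → -¼ * (u (suc l) * ∑[ k < suc l ] u (h ∸ k)) ≈ ∑[ k < suc l ] (-¼ * (u (suc l) * u (h ∸ k)))
    factor l = ≈-trans (*-congˡ { -¼ } (*-distribˡ-∑ (u (suc l)) (suc l) _)) (*-distribˡ-∑ -¼ (suc l) _)

open import Data.Nat using (_>_; _*_)

lemma1 : (p : ℕ) → .{{_ : NonZero p}} → Prime p → p > 3 →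
         (inv : ℕ → ℕ) → IsInverseMod p inv →
         oddEvenPairSum p (λ i j → inv (i * j)) % p ≡ 0
lemma1 p p-prime 3<p inv inverse with odd-prime p-prime (ℕₚ.<-trans (n<1+n 2) 3<p)
... | h , refl = ℕ.n∣m⇒m%n≡0 _ p (Modulo.≈0⇒∣ p (OddPrime.oddEvenPairSum≈0 h p-prime 3<p inv inverse))
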